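{- Let $m \geq 2$ and let $H$ be an $m$-uniform hypergraph. If $H$ is not $m$-partite, then $f_m(r,H) \leq m$ for all $r \geq m$.
   Context: An $m$-uniform hypergraph is $m$-partite if its vertex set can be partitioned into $m$ classes such that every edge has exactly one vertex in each class. An $m$-uniform hypergraph $G$ is an $(r,k)$-hypergraph if $V(G)$ can be partitioned into sets $V_1,\dots,V_r$ with $|V_i| \le k$ for all $i$ such that for every $m$-element subset $\{i_1,\dots,i_m\}$ of $[r]$ there is an edge $e \in E(G)$ with $|e \cap V_{i_j}| = 1$ for $1 \le j \le m$. For an $m$-uniform hypergraph $H$, $f_m(r,H)$ is the minimum $k$ such that there exists an $H$-free $m$-uniform $(r,k)$-hypergraph. -}

module Defs where

open import Data.Nat using (ℕ; _≤_)
open import Data.Fin using (Fin)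
open import Data.Fin.Subset using (Subset; _∈_; ∣_∣)
open import Data.Product using (Σ; ∃; _×_; _,_)
open import Data.Empty using (⊥)
open import Relation.Nullary using (¬_)
open import Relation.Binary.PropositionalEquality using (_≡_)
open import Function.Definitions using (Injective)
open import Data.Fin.Properties using (_≟_)
open import Relation.Nullary.Decidable using (⌊_⌋)
open import Data.Vec using (tabulate)

record Hypergraph : Set₁ where
  field
    n    : ℕ
    Edge : Subset n → Set
open Hypergraph public

Uniform : ℕ → Hypergraph → Set
Uniform m H = ∀ e → Edge H e → ∣ e ∣ ≡ m

ExactlyOne : {n : ℕ} → Subset n → (Fin n → Set) → Set
ExactlyOne {n} e P = Σ (Fin n) λ v → (v ∈ e) × P v × (∀ w → w ∈ e → P w → w ≡ v)

-- m-partite: vertex set partitioned into m (possibly empty) classes,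
-- given by a class map c, such that every edge has exactly one vertex in
-- each class.
Partite : ℕ → Hypergraph → Set
Partite m H = Σ (Fin (n H) → Fin m) λ c →
  ∀ e → Edge H e → ∀ (j : Fin m) → ExactlyOne e (λ v → c v ≡ j)

classOf : {N r : ℕ} → (Fin N → Fin r) → Fin r → Subset N
classOf p i = tabulate (λ v → ⌊ p v ≟ i ⌋)

-- G is an (r,k)-hypergraph (for m-uniform G): a partition p of V(G) into
-- V_1..V_r with |V_i| ≤ k, such that for every m-element S ⊆ [r] some edge
-- meets V_i in exactly one vertex for each i ∈ S.
IsRK : ℕ → ℕ → ℕ → Hypergraph → Set
IsRK m r k G = Σ (Fin (n G) → Fin r) λ p →
  (∀ i → ∣ classOf p i ∣ ≤ k) ×
  (∀ (S : Subset r) → ∣ S ∣ ≡ m →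
     Σ (Subset (n G)) λ e → Edge G e × (∀ i → i ∈ S → ExactlyOne e (λ v → p v ≡ i)))

-- G contains a copy of H: an injective vertex map sending each edge of H
-- onto (exactly the vertex set of) an edge of G.
Contains : Hypergraph → Hypergraph → Set
Contains G H = Σ (Fin (n H) → Fin (n G)) λ φ → Injective _≡_ _≡_ φ ×
  (∀ e → Edge H e → Σ (Subset (n G)) λ f → Edge G f ×
     (∀ w → (w ∈ f → Σ (Fin (n H)) λ v → v ∈ e × φ v ≡ w)
          × (∀ v → v ∈ e → φ v ≡ w → w ∈ f)))

Free : Hypergraph → Hypergraph → Set
Free H G = ¬ Contains G H

{-# OPTIONS --safe #-}
-- Take r blocks of m vertices, the j-th vertex of every block lying in class j,
-- and let the edges be all transversals of the classes. This hypergraph is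
-- m-partite, so a copy of H in it would pull the partition back to H. For an
-- m-set S of blocks, the staircase edge taking the t-th vertex of the t-th block
-- of S meets every class and every block of S exactly once.
module Submission where

open import Defs
open import Data.Nat using (ℕ; _≤_)
open import Data.Product using (Σ; _×_)
open import Relation.Nullary using (¬_)

open import Data.Bool using (Bool; true; false)
open import Data.Empty using (⊥-elim)
open import Data.Fin using (Fin; zero; suc; combine; quotient; remainder)
open import Data.Fin.Properties using (_≟_; suc-injective; remQuot-combine; combine-surjective)
open import Data.Fin.Subset using (Subset; _∈_; ∣_∣; ⊥; ⁅_⁆; inside; outside)
open import Data.Fin.Subset.Properties using (∉⊥; ∣⊥∣≡0; ∣⊤∣≡n; ∣⁅x⁆∣≡1; x∈⁅x⁆; x∈⁅y⁆⇒x≡y)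
open import Data.Nat as ℕ using (_+_; _*_)
open import Data.Nat.Properties using (*-suc; *-zeroʳ; *-identityʳ; ≤-refl; ≤-reflexive)
open import Data.Product using (∃; _,_; proj₁; proj₂)
open import Data.Vec using (Vec; []; _∷_; _++_; concat; tabulate; replicate; lookup; there)
open import Data.Vec.Properties
  using (lookup-concat; lookup∘tabulate; tabulate∘lookup; tabulate-cong; tabulate-allFin; map-const;
         []=⇒lookup; lookup⇒[]=)
open import Function using (id; _∘_)
open import Relation.Nullary.Decidable using (⌊_⌋; ⌊⌋-map′)
open import Relation.Binary.PropositionalEquality
  using (_≡_; refl; sym; trans; cong; cong₂; subst; module ≡-Reasoning)

private
  variable
    A : Set
    r m N : ℕ

Contains⇒Partite : {G H : Hypergraph} → Contains G H → Partite m G → Partite m H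
Contains⇒Partite {H = H} (φ , φ-injective , φ-edge) (c , c-transversal) = c ∘ φ , transversal
  where
  transversal : ∀ e → Edge H e → ∀ j → ExactlyOne e (λ v → c (φ v) ≡ j)
  transversal e e∈H j with φ-edge e e∈H
  ... | f , f∈G , f≡φe with c-transversal f f∈G j
  ... | w , w∈f , cw≡j , w-unique with proj₁ (f≡φe w) w∈f
  ... | v , v∈e , φv≡w =
    v , v∈e , subst (λ x → c x ≡ j) (sym φv≡w) cw≡j ,
    λ v′ v′∈e cφv′≡j →
      φ-injective (trans (w-unique (φ v′) (proj₂ (f≡φe (φ v′)) v′ v′∈e refl) cφv′≡j) (sym φv≡w))

completePartite : ∀ m → (Fin N → Fin m) → Hypergraph
completePartite {N} m c = record
  { n    = N
  ; Edge = λ e → ∣ e ∣ ≡ m × (∀ j → ExactlyOne e (λ v → c v ≡ j))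
  }

completePartite-uniform : (c : Fin N → Fin m) → Uniform m (completePartite m c)
completePartite-uniform c e = proj₁

completePartite-partite : (c : Fin N → Fin m) → Partite m (completePartite m c)
completePartite-partite c = c , λ e → proj₂

quotient-combine : (i : Fin r) (j : Fin m) → quotient m (combine i j) ≡ i
quotient-combine i j = cong proj₁ (remQuot-combine i j)

remainder-combine : (i : Fin r) (j : Fin m) → remainder {r} m (combine i j) ≡ j
remainder-combine i j = cong proj₂ (remQuot-combine i j)

tabulate-const : (x : A) → tabulate {n = N} (λ _ → x) ≡ replicate N x
tabulate-const x = trans (tabulate-allFin _) (map-const _ x)

lookup-concat-tabulate : (row : Fin r → Vec A m) (i : Fin r) (j : Fin m) →
                         lookup (concat (tabulate row)) (combine i j) ≡ lookup (row i) j
lookup-concat-tabulate row i j =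
  trans (lookup-concat (tabulate row) i j) (cong (λ xs → lookup xs j) (lookup∘tabulate row i))

tabulate-combine : (f : Fin (r * m) → A) →
                   tabulate f ≡ concat (tabulate λ (i : Fin r) → tabulate λ (j : Fin m) → f (combine i j))
tabulate-combine {r = r} {m = m} f = trans (tabulate-cong f≗lookup) (tabulate∘lookup _)
  where
  f≗lookup : ∀ v →
             f v ≡ lookup (concat (tabulate λ (i : Fin r) → tabulate λ (j : Fin m) → f (combine i j))) v
  f≗lookup v with combine-surjective {r} {m} v
  ... | i , j , refl =
    sym (trans (lookup-concat-tabulate _ i j) (lookup∘tabulate (f ∘ combine i) j))

∈-concat⁺ : (row : Fin r → Subset m) {i : Fin r} {j : Fin m} →
            j ∈ row i → combine i j ∈ concat (tabulate row)
∈-concat⁺ row {i} {j} j∈ = lookup⇒[]= _ _ (trans (lookup-concat-tabulate row i j) ([]=⇒lookup j∈))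

∈-concat⁻ : (row : Fin r → Subset m) {i : Fin r} {j : Fin m} →
            combine i j ∈ concat (tabulate row) → j ∈ row i
∈-concat⁻ row {i} {j} ij∈ = lookup⇒[]= _ _ (trans (sym (lookup-concat-tabulate row i j)) ([]=⇒lookup ij∈))

ExactlyOne-concat : (row : Fin r → Subset m) {P : Fin (r * m) → Set} (i : Fin r) (j : Fin m) →
                    j ∈ row i → P (combine i j) →
                    (∀ i′ j′ → j′ ∈ row i′ → P (combine i′ j′) → i′ ≡ i × j′ ≡ j) →
                    ExactlyOne (concat (tabulate row)) P
ExactlyOne-concat {r} {m} row {P} i j j∈ Pij unique = combine i j , ∈-concat⁺ row j∈ , Pij , only
  where
  only : ∀ w → w ∈ concat (tabulate row) → P w → w ≡ combine i j
  only w w∈ Pw with combine-surjective {r} {m} w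
  ... | i′ , j′ , refl with unique i′ j′ (∈-concat⁻ row w∈) Pw
  ... | refl , refl = refl

∣p++q∣≡∣p∣+∣q∣ : (p : Subset m) (q : Subset N) → ∣ p ++ q ∣ ≡ ∣ p ∣ + ∣ q ∣
∣p++q∣≡∣p∣+∣q∣ []            q = refl
∣p++q∣≡∣p∣+∣q∣ (inside  ∷ p) q = cong (1 +_) (∣p++q∣≡∣p∣+∣q∣ p q)
∣p++q∣≡∣p∣+∣q∣ (outside ∷ p) q = ∣p++q∣≡∣p∣+∣q∣ p q

∣concat-replicate∣ : (f : Fin r → Bool) →
                     ∣ concat (tabulate λ i → replicate m (f i)) ∣ ≡ m * ∣ tabulate f ∣
∣concat-replicate∣ {ℕ.zero}  {m} f = sym (*-zeroʳ m)
∣concat-replicate∣ {ℕ.suc r} {m} f = begin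
  ∣ replicate m (f zero) ++ rest ∣
    ≡⟨ ∣p++q∣≡∣p∣+∣q∣ (replicate m (f zero)) rest ⟩
  ∣ replicate m (f zero) ∣ + ∣ rest ∣
    ≡⟨ cong (∣ replicate m (f zero) ∣ +_) (∣concat-replicate∣ (f ∘ suc)) ⟩
  ∣ replicate m (f zero) ∣ + m * ∣ tabulate (f ∘ suc) ∣
    ≡⟨ block (f zero) (tabulate (f ∘ suc)) ⟩
  m * ∣ tabulate f ∣ ∎
  where
  open ≡-Reasoning
  rest : Subset (r * m)
  rest = concat (tabulate λ i → replicate m (f (suc i)))
  block : ∀ b (s : Subset r) → ∣ replicate m b ∣ + m * ∣ s ∣ ≡ m * ∣ b ∷ s ∣
  block true  s = trans (cong (_+ m * ∣ s ∣) (∣⊤∣≡n m)) (sym (*-suc m ∣ s ∣))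
  block false s = cong (_+ m * ∣ s ∣) (∣⊥∣≡0 m)

classOf-id : (i : Fin r) → classOf id i ≡ ⁅ i ⁆
classOf-id zero    = cong (inside ∷_) (tabulate-const outside)
classOf-id (suc i) =
  cong (outside ∷_) (trans (tabulate-cong λ x → ⌊⌋-map′ (cong suc) suc-injective (x ≟ i)) (classOf-id i))

∣classOf-quotient∣ : (i : Fin r) → ∣ classOf (quotient {r} m) i ∣ ≡ m
∣classOf-quotient∣ {r} {m} i = begin
  ∣ classOf (quotient {r} m) i ∣
    ≡⟨ cong ∣_∣ (tabulate-combine {r = r} {m = m} (λ v → ⌊ quotient {r} m v ≟ i ⌋)) ⟩
  ∣ concat (tabulate λ (i′ : Fin r) → tabulate λ (j : Fin m) → ⌊ quotient m (combine i′ j) ≟ i ⌋) ∣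
    ≡⟨ cong (∣_∣ ∘ concat) (tabulate-cong constantRows) ⟩
  ∣ concat (tabulate λ i′ → replicate m ⌊ i′ ≟ i ⌋) ∣
    ≡⟨ ∣concat-replicate∣ (λ i′ → ⌊ i′ ≟ i ⌋) ⟩
  m * ∣ classOf id i ∣
    ≡⟨ cong (λ s → m * ∣ s ∣) (classOf-id i) ⟩
  m * ∣ ⁅ i ⁆ ∣
    ≡⟨ cong (m *_) (∣⁅x⁆∣≡1 i) ⟩
  m * 1
    ≡⟨ *-identityʳ m ⟩
  m ∎
  where
  open ≡-Reasoning
  constantRows : ∀ i′ → tabulate (λ j → ⌊ quotient {r} m (combine i′ j) ≟ i ⌋) ≡ replicate m ⌊ i′ ≟ i ⌋
  constantRows i′ =
    trans (tabulate-cong λ j → cong (λ q → ⌊ q ≟ i ⌋) (quotient-combine i′ j)) (tabulate-const _)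

-- Row i is ⁅ t ⁆ when i is the t-th element of S, and empty when i ∉ S.
staircaseRow : (S : Subset r) → Fin r → Subset ∣ S ∣
staircaseRow (inside  ∷ S) zero    = ⁅ zero ⁆
staircaseRow (inside  ∷ S) (suc i) = outside ∷ staircaseRow S i
staircaseRow (outside ∷ S) zero    = ⊥
staircaseRow (outside ∷ S) (suc i) = staircaseRow S i

staircase : (S : Subset r) → Subset (r * ∣ S ∣)
staircase S = concat (tabulate (staircaseRow S))

staircaseRow-∈ : (S : Subset r) (i : Fin r) → i ∈ S → ∃ λ t → staircaseRow S i ≡ ⁅ t ⁆
staircaseRow-∈ (inside  ∷ S) zero    _         = zero , refl
staircaseRow-∈ (outside ∷ S) zero    ()
staircaseRow-∈ (inside  ∷ S) (suc i) (there i∈) with staircaseRow-∈ S i i∈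
... | t , row≡ = suc t , cong (outside ∷_) row≡
staircaseRow-∈ (outside ∷ S) (suc i) (there i∈) = staircaseRow-∈ S i i∈

staircaseRow-column : (S : Subset r) (t : Fin ∣ S ∣) →
                      ∃ λ i → t ∈ staircaseRow S i × (∀ i′ → t ∈ staircaseRow S i′ → i′ ≡ i)
staircaseRow-column (inside ∷ S) zero = zero , x∈⁅x⁆ zero , only
  where
  only : ∀ i′ → zero ∈ staircaseRow (inside ∷ S) i′ → i′ ≡ zero
  only zero    _  = refl
  only (suc i′) ()
staircaseRow-column (inside ∷ S) (suc t) with staircaseRow-column S t
... | i , t∈ , unique = suc i , there t∈ , only
  where
  only : ∀ i′ → suc t ∈ staircaseRow (inside ∷ S) i′ → i′ ≡ suc i
  only zero     (there t∈⊥) = ⊥-elim (∉⊥ t∈⊥)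
  only (suc i′) (there t∈′) = cong suc (unique i′ t∈′)
staircaseRow-column (outside ∷ S) t with staircaseRow-column S t
... | i , t∈ , unique = suc i , t∈ , only
  where
  only : ∀ i′ → t ∈ staircaseRow (outside ∷ S) i′ → i′ ≡ suc i
  only zero     t∈⊥ = ⊥-elim (∉⊥ t∈⊥)
  only (suc i′) t∈′ = cong suc (unique i′ t∈′)

∣concat-outside∷∣ : (row : Fin r → Subset m) →
                    ∣ concat (tabulate λ i → outside ∷ row i) ∣ ≡ ∣ concat (tabulate row) ∣
∣concat-outside∷∣ {ℕ.zero}      row = refl
∣concat-outside∷∣ {ℕ.suc r} {m} row = begin
  ∣ (outside ∷ row zero) ++ concat (tabulate λ i → outside ∷ row (suc i)) ∣
    ≡⟨ ∣p++q∣≡∣p∣+∣q∣ (outside ∷ row zero) _ ⟩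
  ∣ row zero ∣ + ∣ concat (tabulate λ i → outside ∷ row (suc i)) ∣
    ≡⟨ cong (∣ row zero ∣ +_) (∣concat-outside∷∣ (row ∘ suc)) ⟩
  ∣ row zero ∣ + ∣ concat (tabulate (row ∘ suc)) ∣
    ≡⟨ sym (∣p++q∣≡∣p∣+∣q∣ (row zero) _) ⟩
  ∣ concat (tabulate row) ∣ ∎
  where open ≡-Reasoning

∣staircase∣ : (S : Subset r) → ∣ staircase S ∣ ≡ ∣ S ∣
∣staircase∣ []            = refl
∣staircase∣ (inside  ∷ S) = begin
  ∣ ⁅ zero {∣ S ∣} ⁆ ++ concat (tabulate λ i → outside ∷ staircaseRow S i) ∣
    ≡⟨ ∣p++q∣≡∣p∣+∣q∣ ⁅ zero {∣ S ∣} ⁆ _ ⟩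
  ∣ ⁅ zero {∣ S ∣} ⁆ ∣ + ∣ concat (tabulate λ i → outside ∷ staircaseRow S i) ∣
    ≡⟨ cong₂ _+_ (∣⁅x⁆∣≡1 (zero {∣ S ∣}))
                 (trans (∣concat-outside∷∣ (staircaseRow S)) (∣staircase∣ S)) ⟩
  1 + ∣ S ∣ ∎
  where open ≡-Reasoning
∣staircase∣ (outside ∷ S) = begin
  ∣ ⊥ {∣ S ∣} ++ staircase S ∣    ≡⟨ ∣p++q∣≡∣p∣+∣q∣ (⊥ {∣ S ∣}) (staircase S) ⟩
  ∣ ⊥ {∣ S ∣} ∣ + ∣ staircase S ∣ ≡⟨ cong₂ _+_ (∣⊥∣≡0 ∣ S ∣) (∣staircase∣ S) ⟩
  ∣ S ∣ ∎
  where open ≡-Reasoning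

staircase-block : (S : Subset r) (i : Fin r) → i ∈ S →
                  ExactlyOne (staircase S) (λ v → quotient ∣ S ∣ v ≡ i)
staircase-block S i i∈S with staircaseRow-∈ S i i∈S
... | t , row≡ =
  ExactlyOne-concat (staircaseRow S) i t (subst (t ∈_) (sym row≡) (x∈⁅x⁆ t)) (quotient-combine i t) only
  where
  only : ∀ i′ t′ → t′ ∈ staircaseRow S i′ → quotient ∣ S ∣ (combine i′ t′) ≡ i →
         i′ ≡ i × t′ ≡ t
  only i′ t′ t′∈ q with trans (sym (quotient-combine i′ t′)) q
  ... | refl = refl , x∈⁅y⁆⇒x≡y t (subst (t′ ∈_) row≡ t′∈)

staircase-column : (S : Subset r) (t : Fin ∣ S ∣) →
                   ExactlyOne (staircase S) (λ v → remainder {r} ∣ S ∣ v ≡ t)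
staircase-column {r} S t with staircaseRow-column S t
... | i , t∈ , unique = ExactlyOne-concat (staircaseRow S) i t t∈ (remainder-combine i t) only
  where
  only : ∀ i′ t′ → t′ ∈ staircaseRow S i′ → remainder {r} ∣ S ∣ (combine i′ t′) ≡ t →
         i′ ≡ i × t′ ≡ t
  only i′ t′ t′∈ q with trans (sym (remainder-combine i′ t′)) q
  ... | refl = unique i′ t′∈ , refl

staircaseEdge : (S : Subset r) → ∣ S ∣ ≡ m →
                Σ (Subset (r * m)) λ e → Edge (completePartite m (remainder {r} m)) e ×
                  (∀ i → i ∈ S → ExactlyOne e (λ v → quotient m v ≡ i))
staircaseEdge S refl = staircase S , (∣staircase∣ S , staircase-column S) , staircase-block S

completePartite-isRK : ∀ r m → IsRK m r m (completePartite m (remainder {r} m))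
completePartite-isRK r m = quotient m , (λ i → ≤-reflexive (∣classOf-quotient∣ i)) , staircaseEdge

corollary2p3 : (m : ℕ) → 2 ≤ m → (H : Hypergraph) → Uniform m H → ¬ Partite m H →
    (r : ℕ) → m ≤ r →
    Σ ℕ λ k → k ≤ m × Σ Hypergraph λ G → Uniform m G × IsRK m r k G × Free H G
corollary2p3 m _ H _ ¬partite r _ =
  m , ≤-refl , completePartite m (remainder {r} m) ,
  completePartite-uniform (remainder {r} m) , completePartite-isRK r m ,
  λ G⊇H → ¬partite (Contains⇒Partite G⊇H (completePartite-partite (remainder {r} m)))
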